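{- If $G$ is an orientation of a connected cubic graph and $G$ has a source vertex adjacent to a sink vertex, then $\chi_{2d}(G) \leq 7$.
   Context: An oriented graph is a loopless antisymmetric digraph. A source is a vertex of in-degree $0$, a sink a vertex of out-degree $0$. A $2$-dipath $t$-colouring of an oriented graph $G$ is a map $c:V(G)\to\{0,1,\dots,t-1\}$ such that $c(u)\neq c(v)$ for every arc $uv\in A(G)$, and $c(u)\neq c(w)$ whenever $uv,vw\in A(G)$. The $2$-dipath chromatic number $\chi_{2d}(G)$ is the least $t$ such that $G$ admits a $2$-dipath $t$-colouring. -}

module Defs where

open import Data.Nat using (ℕ; zero; suc; _≤_)
open import Data.Fin using (Fin)
open import Data.Bool using (Bool; true; false; _∨_)
open import Data.List using (List; filter; length; allFin)
open import Data.Product using (_×_; Σ; ∃; ∃-syntax; _,_)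
open import Relation.Binary.PropositionalEquality using (_≡_; _≢_)
open import Relation.Nullary using (¬_)
open import Data.Bool.Properties using (T?)

Digraph : ℕ → Set
Digraph n = Fin n → Fin n → Bool

IsOriented : ∀ {n} → Digraph n → Set
IsOriented {n} A =
  ((u : Fin n) → A u u ≡ false) ×
  ((u v : Fin n) → A u v ≡ true → A v u ≡ false)

adj : ∀ {n} → Digraph n → Fin n → Fin n → Bool
adj A u v = A u v ∨ A v u

degree : ∀ {n} → Digraph n → Fin n → ℕ
degree {n} A u = length (filter (λ v → T? (adj A u v)) (allFin n))

IsCubic : ∀ {n} → Digraph n → Set
IsCubic {n} A = (u : Fin n) → degree A u ≡ 3

data Walk {n} (A : Digraph n) : Fin n → Fin n → Set where
  here : ∀ {u} → Walk A u u
  step : ∀ {u v w} → adj A u v ≡ true → Walk A v w → Walk A u w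

IsConnected : ∀ {n} → Digraph n → Set
IsConnected {n} A = (u v : Fin n) → Walk A u v

IsSource : ∀ {n} → Digraph n → Fin n → Set
IsSource {n} A v = (u : Fin n) → A u v ≡ false

IsSink : ∀ {n} → Digraph n → Fin n → Set
IsSink {n} A v = (w : Fin n) → A v w ≡ false

Is2DipathColouring : ∀ {n} → Digraph n → (t : ℕ) → (Fin n → Fin t) → Set
Is2DipathColouring {n} A t c =
  ((u v : Fin n) → A u v ≡ true → c u ≢ c v) ×
  ((u v w : Fin n) → A u v ≡ true → A v w ≡ true → c u ≢ c w)

Has2DipathColouring : ∀ {n} → Digraph n → ℕ → Set
Has2DipathColouring A t = ∃[ c ] Is2DipathColouring A t c

χ2d≤ : ∀ {n} → Digraph n → ℕ → Set
χ2d≤ A k = ∃[ t ] (t ≤ k × Has2DipathColouring A t)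

module Submission where

-- Two vertices are in *conflict* when they are adjacent or are the ends of
-- a directed 2-path; a 2-dipath colouring is a proper colouring of this
-- conflict relation.  We colour greedily: if every nonempty vertex set W
-- contains a vertex x with at most 6 conflicts inside W, then colouring
-- W - x first and x last needs only 7 colours (module GreedyColouring).
--
-- Through each of its three neighbours z, a vertex x has at most three
-- conflicts (z and the two other neighbours of z), and at most two of them
-- lie in W unless z "points to" x: z and both other neighbours of z lie
-- in W and form directed 2-paths with x through z.  Orientation forces a
-- vertex to point to at most one vertex, a vertex with a neighbour outside
-- W (or the source, when W is everything) points to none, so by pigeonhole
-- some x ∈ W is pointed to by nobody; it has at most 3 · 2 = 6 conflicts
-- in W (module CubicOrientation).

open import Defs
open import Data.Nat using (ℕ; zero; suc; _+_; _*_; _<_)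
open import Data.Nat.Properties using (≤-refl; n<1+n; n≮n; <⇒≱)
open import Data.Nat.Induction using (<-wellFounded)
open import Induction.WellFounded using (Acc; acc)
open import Data.Fin using (Fin; zero; suc; punchOut; _↑ˡ_; _↑ʳ_)
open import Data.Fin.Properties using (_≟_; any?; all?; ¬∀⟶∃¬; injective⇒≤; punchOut-injective)
open import Data.Fin.Subset using (Subset; _∈_; _∉_; _-_; ⊤; Nonempty; ∣_∣)
open import Data.Fin.Subset.Properties using (_∈?_; nonempty?; ∈⊤; x∈p⇒∣p-x∣<∣p∣; x∈p∧x≢y⇒x∈p-y)
open import Data.Vec.Functional using (updateAt; _++_)
open import Data.Vec.Functional.Properties using (updateAt-updates; updateAt-minimal; lookup-++ˡ; lookup-++ʳ)
open import Data.Bool using (true; false)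
open import Data.Bool.Properties using (T?; T-≡; ∨-comm; ∨-zeroʳ; ∨-idem) renaming (_≟_ to _≟ᵇ_)
open import Data.List using (List; []; _∷_; filter; length; allFin)
open import Data.List.Relation.Unary.Any using (here; there)
open import Data.List.Relation.Unary.All using ([]; _∷_)
open import Data.List.Relation.Unary.AllPairs using ([]; _∷_)
open import Data.List.Relation.Unary.Unique.Propositional using (Unique)
open import Data.List.Relation.Unary.Unique.Propositional.Properties using (allFin⁺; filter⁺)
open import Data.List.Membership.Propositional using () renaming (_∈_ to _∈ₗ_)
open import Data.List.Membership.Propositional.Properties using (∈-filter⁺; ∈-filter⁻; ∈-allFin)
open import Data.Product using (_×_; Σ; ∃; ∃₂; ∃-syntax; _,_; proj₁; proj₂)
open import Data.Sum using (_⊎_; inj₁; inj₂; [_,_]′)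
open import Data.Empty using (⊥; ⊥-elim)
open import Function using (_∘_; Equivalence)
open import Function.Definitions using (Injective)
open import Relation.Nullary using (¬_; Dec; yes; no; contradiction)
open import Relation.Nullary.Decidable using (_×-dec_; _⊎-dec_; _→-dec_; ¬?; decidable-stable)
open import Relation.Binary.PropositionalEquality using (_≡_; _≢_; refl; sym; trans; cong; subst; ≢-sym; module ≡-Reasoning)

-- A map into a strictly larger finite set misses some value: otherwise a
-- choice of preimages would inject the larger set into the smaller one.
missedValue : ∀ {m k} → m < k → (f : Fin m → Fin k) → ∃[ y ] (∀ i → f i ≢ y)
missedValue {m} {k} m<k f with any? (λ y → all? (λ i → ¬? (f i ≟ y)))
... | yes missed = missed
... | no  none   = contradiction (injective⇒≤ section-injective) (<⇒≱ m<k)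
  where
    preimage : ∀ y → ∃[ i ] f i ≡ y
    preimage y with ¬∀⟶∃¬ m (λ i → f i ≢ y) (λ i → ¬? (f i ≟ y)) (λ f≢y → none (y , f≢y))
    ... | i , ¬f≢y = i , decidable-stable (f i ≟ y) ¬f≢y

    section-injective : Injective _≡_ _≡_ (proj₁ ∘ preimage)
    section-injective {y} {y′} same =
      trans (sym (proj₂ (preimage y))) (trans (cong f same) (proj₂ (preimage y′)))

-- An injective self-map of a finite set misses no value: otherwise it
-- would inject Fin (suc m) into Fin m by punching out the missed value.
injective⇒hits : ∀ {n} (f : Fin n → Fin n) → Injective _≡_ _≡_ f → (y : Fin n) → ¬ (∀ x → f x ≢ y)
injective⇒hits {suc m} f f-injective y misses = n≮n m (injective⇒≤ punched-injective)
  where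
    punched : Fin (suc m) → Fin m
    punched x = punchOut (misses x ∘ sym)

    punched-injective : Injective _≡_ _≡_ punched
    punched-injective {x} {x′} same =
      f-injective (punchOut-injective (misses x ∘ sym) (misses x′ ∘ sym) same)

-- The elements satisfying P are among the d entries of some tuple.  This
-- is how "P has at most d elements" is expressed and counted below.
CoveredBy : {A : Set} → ℕ → (A → Set) → Set
CoveredBy {A} d P = Σ (Fin d → A) λ entries → ∀ {v} → P v → ∃[ i ] entries i ≡ v

covered-mono : ∀ {A : Set} {d} {P Q : A → Set} → (∀ {v} → P v → Q v) → CoveredBy d Q → CoveredBy d P
covered-mono P⇒Q (entries , covers) = entries , covers ∘ P⇒Q

covered-∪ : ∀ {A : Set} {m k} {P Q : A → Set} →
            CoveredBy m P → CoveredBy k Q → CoveredBy (m + k) (λ v → P v ⊎ Q v)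
covered-∪ {m = m} {k} {P} {Q} (xs , coversP) (ys , coversQ) = xs ++ ys , covers
  where
    covers : ∀ {v} → P v ⊎ Q v → ∃[ i ] (xs ++ ys) i ≡ v
    covers (inj₁ p) with coversP p
    ... | i , xsᵢ≡v = i ↑ˡ k , trans (lookup-++ˡ xs ys i) xsᵢ≡v
    covers (inj₂ q) with coversQ q
    ... | i , ysᵢ≡v = m ↑ʳ i , trans (lookup-++ʳ xs ys i) ysᵢ≡v

covered-⋃ : ∀ {A : Set} {k} (l : List A) {P : A → A → Set} →
            (∀ {z} → z ∈ₗ l → CoveredBy k (P z)) →
            CoveredBy (length l * k) (λ v → ∃[ z ] z ∈ₗ l × P z v)
covered-⋃ [] _ = (λ ()) , λ { (_ , () , _) }
covered-⋃ (z ∷ l) {P} covers =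
  covered-mono headOrTail (covered-∪ (covers (here refl)) (covered-⋃ l (covers ∘ there)))
  where
    headOrTail : ∀ {v} → ∃[ z′ ] z′ ∈ₗ z ∷ l × P z′ v → P z v ⊎ ∃[ z′ ] z′ ∈ₗ l × P z′ v
    headOrTail (_ , here refl , p) = inj₁ p
    headOrTail (z′ , there z′∈l , p) = inj₂ (z′ , z′∈l , p)

coveredByTwo : ∀ {A : Set} {P : A → Set} (a b : A) → (∀ {v} → P v → v ≡ a ⊎ v ≡ b) → CoveredBy 2 P
coveredByTwo {A} a b only = pair , λ p → [ (λ v≡a → zero , sym v≡a) , (λ v≡b → suc zero , sym v≡b) ]′ (only p)
  where
    pair : Fin 2 → A
    pair zero = a
    pair (suc _) = b

coveredByTwoOfThree : ∀ {A : Set} {P : A → Set} (a b c : A) →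
                      (∀ {v} → P v → v ≡ a ⊎ v ≡ b ⊎ v ≡ c) → ¬ P a ⊎ ¬ P b ⊎ ¬ P c → CoveredBy 2 P
coveredByTwoOfThree {P = P} a b c only (inj₁ ¬Pa) = coveredByTwo b c onlyBC
  where
    onlyBC : ∀ {v} → P v → v ≡ b ⊎ v ≡ c
    onlyBC p with only p
    ... | inj₁ refl = ⊥-elim (¬Pa p)
    ... | inj₂ v≡b⊎c = v≡b⊎c
coveredByTwoOfThree {P = P} a b c only (inj₂ (inj₁ ¬Pb)) = coveredByTwo a c onlyAC
  where
    onlyAC : ∀ {v} → P v → v ≡ a ⊎ v ≡ c
    onlyAC p with only p
    ... | inj₁ v≡a = inj₁ v≡a
    ... | inj₂ (inj₁ refl) = ⊥-elim (¬Pb p)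
    ... | inj₂ (inj₂ v≡c) = inj₂ v≡c
coveredByTwoOfThree {P = P} a b c only (inj₂ (inj₂ ¬Pc)) = coveredByTwo a b onlyAB
  where
    onlyAB : ∀ {v} → P v → v ≡ a ⊎ v ≡ b
    onlyAB p with only p
    ... | inj₁ v≡a = inj₁ v≡a
    ... | inj₂ (inj₁ v≡b) = inj₂ v≡b
    ... | inj₂ (inj₂ refl) = ⊥-elim (¬Pc p)

record OtherTwo {A : Set} (l : List A) (x : A) : Set where
  field
    q r : A
    q∈l : q ∈ₗ l
    r∈l : r ∈ₗ l
    q≢x : q ≢ x
    r≢x : r ≢ x
    q≢r : q ≢ r
    exhaust : ∀ {y} → y ∈ₗ l → y ≡ x ⊎ y ≡ q ⊎ y ≡ r

otherTwo : ∀ {A : Set} {x : A} (l : List A) → length l ≡ 3 → Unique l → x ∈ₗ l → OtherTwo l x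
otherTwo (a ∷ b ∷ c ∷ []) refl ((a≢b ∷ a≢c ∷ []) ∷ (b≢c ∷ []) ∷ _) (here refl) =
  record { q = b ; r = c ; q∈l = there (here refl) ; r∈l = there (there (here refl))
         ; q≢x = ≢-sym a≢b ; r≢x = ≢-sym a≢c ; q≢r = b≢c ; exhaust = members }
  where
    members : ∀ {y} → y ∈ₗ a ∷ b ∷ c ∷ [] → y ≡ a ⊎ y ≡ b ⊎ y ≡ c
    members (here y≡a) = inj₁ y≡a
    members (there (here y≡b)) = inj₂ (inj₁ y≡b)
    members (there (there (here y≡c))) = inj₂ (inj₂ y≡c)
otherTwo (a ∷ b ∷ c ∷ []) refl ((a≢b ∷ a≢c ∷ []) ∷ (b≢c ∷ []) ∷ _) (there (here refl)) =
  record { q = a ; r = c ; q∈l = here refl ; r∈l = there (there (here refl))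
         ; q≢x = a≢b ; r≢x = ≢-sym b≢c ; q≢r = a≢c ; exhaust = members }
  where
    members : ∀ {y} → y ∈ₗ a ∷ b ∷ c ∷ [] → y ≡ b ⊎ y ≡ a ⊎ y ≡ c
    members (here y≡a) = inj₂ (inj₁ y≡a)
    members (there (here y≡b)) = inj₁ y≡b
    members (there (there (here y≡c))) = inj₂ (inj₂ y≡c)
otherTwo (a ∷ b ∷ c ∷ []) refl ((a≢b ∷ a≢c ∷ []) ∷ (b≢c ∷ []) ∷ _) (there (there (here refl))) =
  record { q = a ; r = b ; q∈l = here refl ; r∈l = there (here refl)
         ; q≢x = a≢c ; r≢x = b≢c ; q≢r = a≢b ; exhaust = members }
  where
    members : ∀ {y} → y ∈ₗ a ∷ b ∷ c ∷ [] → y ≡ c ⊎ y ≡ a ⊎ y ≡ b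
    members (here y≡a) = inj₂ (inj₁ y≡a)
    members (there (here y≡b)) = inj₂ (inj₂ y≡b)
    members (there (there (here y≡c))) = inj₁ y≡c

module GreedyColouring {n : ℕ} (d : ℕ) (R : Fin n → Fin n → Set)
                       (R-sym : ∀ {u v} → R u v → R v u) (R-irrefl : ∀ {u} → ¬ R u u) where

  ProperOn : Subset n → (Fin n → Fin (suc d)) → Set
  ProperOn W c = ∀ {u v} → u ∈ W → v ∈ W → R u v → c u ≢ c v

  Removable : Subset n → Fin n → Set
  Removable W x = x ∈ W × CoveredBy d (λ v → v ∈ W × R x v)

  -- Colouring x with a colour unused by its at most d neighbours in W
  -- extends a proper colouring of W - x to W.
  extendColouring : ∀ {W x} → Removable W x → ∃ (ProperOn (W - x)) → ∃ (ProperOn W)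
  extendColouring {W} {x} (x∈W , nbrs , covers) (c , proper) = c′ , proper′
    where
      free : ∃[ col ] (∀ i → c (nbrs i) ≢ col)
      free = missedValue (n<1+n d) (c ∘ nbrs)

      c′ : Fin n → Fin (suc d)
      c′ = updateAt c x (λ _ → proj₁ free)

      c′-off-x : ∀ {v} → v ≢ x → c′ v ≡ c v
      c′-off-x {v} v≢x = updateAt-minimal v x c v≢x

      fresh : ∀ {v} → v ∈ W → R x v → c′ x ≢ c′ v
      fresh {v} v∈W xv c′x≡c′v with covers (v∈W , xv)
      ... | i , nbrᵢ≡v = proj₂ free i (begin
            c (nbrs i)  ≡⟨ cong c nbrᵢ≡v ⟩
            c v         ≡⟨ sym (c′-off-x v≢x) ⟩
            c′ v        ≡⟨ sym c′x≡c′v ⟩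
            c′ x        ≡⟨ updateAt-updates x c ⟩
            proj₁ free  ∎)
        where
          open ≡-Reasoning
          v≢x : v ≢ x
          v≢x refl = R-irrefl xv

      proper′ : ProperOn W c′
      proper′ {u} {v} u∈W v∈W uv with u ≟ x | v ≟ x
      ... | yes refl | yes refl = ⊥-elim (R-irrefl uv)
      ... | yes refl | no _     = fresh v∈W uv
      ... | no _     | yes refl = fresh u∈W (R-sym uv) ∘ sym
      ... | no u≢x   | no v≢x   = λ c′u≡c′v →
        proper (x∈p∧x≢y⇒x∈p-y u∈W u≢x) (x∈p∧x≢y⇒x∈p-y v∈W v≢x) uv
               (trans (sym (c′-off-x u≢x)) (trans c′u≡c′v (c′-off-x v≢x)))

  colourSubset : (∀ W → Nonempty W → ∃ (Removable W)) → ∀ W → Acc _<_ ∣ W ∣ → ∃ (ProperOn W)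
  colourSubset removable W (acc smaller) with nonempty? W
  ... | no empty = (λ _ → zero) , λ u∈W _ _ → ⊥-elim (empty (_ , u∈W))
  ... | yes nonempty with removable W nonempty
  ...   | x , x-removable@(x∈W , _) =
          extendColouring x-removable (colourSubset removable (W - x) (smaller (x∈p⇒∣p-x∣<∣p∣ x∈W)))

  greedy : (∀ W → Nonempty W → ∃ (Removable W)) → ∃[ c ] (∀ {u v} → R u v → c u ≢ c v)
  greedy removable with colourSubset removable ⊤ (<-wellFounded _)
  ... | c , proper = c , proper ∈⊤ ∈⊤

module CubicOrientation {n : ℕ} (G : Digraph n) (oriented : IsOriented G) (cubic : IsCubic G) where

  Arc : Fin n → Fin n → Set
  Arc u v = G u v ≡ true

  Adj : Fin n → Fin n → Set
  Adj u v = adj G u v ≡ true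

  noArc : ∀ {u v} → G u v ≡ false → ¬ Arc u v
  noArc absent present with trans (sym absent) present
  ... | ()

  arc-antisym : ∀ {u v} → Arc u v → Arc v u → ⊥
  arc-antisym {u} {v} uv = noArc (proj₂ oriented u v uv)

  arc-irrefl : ∀ {u} → ¬ Arc u u
  arc-irrefl {u} = noArc (proj₁ oriented u)

  arc⇒adj : ∀ {u v} → Arc u v → Adj u v
  arc⇒adj uv rewrite uv = refl

  arc⇒adj˘ : ∀ {u v} → Arc v u → Adj u v
  arc⇒adj˘ {u} {v} vu rewrite vu = ∨-zeroʳ (G u v)

  adj-sym : ∀ {u v} → Adj u v → Adj v u
  adj-sym {u} {v} uv = trans (∨-comm (G v u) (G u v)) uv

  adj-irrefl : ∀ {u} → ¬ Adj u u
  adj-irrefl {u} uu = arc-irrefl (trans (sym (∨-idem (G u u))) uu)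

  Dipath : Fin n → Fin n → Fin n → Set
  Dipath x z y = (Arc x z × Arc z y) ⊎ (Arc y z × Arc z x)

  dipath? : ∀ x z y → Dec (Dipath x z y)
  dipath? x z y = ((G x z ≟ᵇ true) ×-dec (G z y ≟ᵇ true)) ⊎-dec
                  ((G y z ≟ᵇ true) ×-dec (G z x ≟ᵇ true))

  dipath-irrefl : ∀ {x z} → ¬ Dipath x z x
  dipath-irrefl (inj₁ (xz , zx)) = arc-antisym xz zx
  dipath-irrefl (inj₂ (xz , zx)) = arc-antisym xz zx

  dipath-adjˡ : ∀ {x z y} → Dipath x z y → Adj x z
  dipath-adjˡ (inj₁ (xz , _)) = arc⇒adj xz
  dipath-adjˡ (inj₂ (_ , zx)) = arc⇒adj˘ zx

  dipath-adjʳ : ∀ {x z y} → Dipath x z y → Adj z y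
  dipath-adjʳ (inj₁ (_ , zy)) = arc⇒adj zy
  dipath-adjʳ (inj₂ (yz , _)) = arc⇒adj˘ yz

  -- A 2-path x z y joins an in-neighbour of z to an out-neighbour, so no
  -- three neighbours of z can be pairwise joined by 2-paths through z.
  noDipathTriangle : ∀ {x z x′ y} → Dipath x z x′ → Dipath x z y → Dipath x′ z y → ⊥
  noDipathTriangle (inj₁ (_ , zx′)) (inj₁ _) (inj₁ (x′z , _)) = arc-antisym zx′ x′z
  noDipathTriangle (inj₁ _) (inj₁ (_ , zy)) (inj₂ (yz , _)) = arc-antisym zy yz
  noDipathTriangle (inj₁ (xz , _)) (inj₂ (_ , zx)) _ = arc-antisym xz zx
  noDipathTriangle (inj₂ (_ , zx)) (inj₁ (xz , _)) _ = arc-antisym zx xz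
  noDipathTriangle (inj₂ _) (inj₂ (yz , _)) (inj₁ (_ , zy)) = arc-antisym yz zy
  noDipathTriangle (inj₂ (x′z , _)) (inj₂ _) (inj₂ (_ , zx′)) = arc-antisym x′z zx′

  Conflict : Fin n → Fin n → Set
  Conflict u v = Arc u v ⊎ Arc v u ⊎ ∃[ z ] Dipath u z v

  conflict-sym : ∀ {u v} → Conflict u v → Conflict v u
  conflict-sym (inj₁ uv) = inj₂ (inj₁ uv)
  conflict-sym (inj₂ (inj₁ vu)) = inj₁ vu
  conflict-sym (inj₂ (inj₂ (z , inj₁ path))) = inj₂ (inj₂ (z , inj₂ path))
  conflict-sym (inj₂ (inj₂ (z , inj₂ path))) = inj₂ (inj₂ (z , inj₁ path))

  conflict-irrefl : ∀ {u} → ¬ Conflict u u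
  conflict-irrefl (inj₁ uu) = arc-irrefl uu
  conflict-irrefl (inj₂ (inj₁ uu)) = arc-irrefl uu
  conflict-irrefl (inj₂ (inj₂ (_ , path))) = dipath-irrefl path

  neighbours : Fin n → List (Fin n)
  neighbours u = filter (λ v → T? (adj G u v)) (allFin n)

  adj⇒neighbour : ∀ {u v} → Adj u v → v ∈ₗ neighbours u
  adj⇒neighbour {u} {v} uv = ∈-filter⁺ (λ w → T? (adj G u w)) (∈-allFin v) (Equivalence.from T-≡ uv)

  neighbour⇒adj : ∀ {u v} → v ∈ₗ neighbours u → Adj u v
  neighbour⇒adj {u} v∈ = Equivalence.to T-≡ (proj₂ (∈-filter⁻ (λ w → T? (adj G u w)) {xs = allFin n} v∈))

  others : ∀ {z x} → Adj z x → OtherTwo (neighbours z) x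
  others {z} zx = otherTwo (neighbours z) (cubic z)
                           (filter⁺ (λ w → T? (adj G z w)) (allFin⁺ n)) (adj⇒neighbour zx)

  thirdNeighbour : ∀ {z x x′} → Adj z x → Adj z x′ → x ≢ x′ → ∃[ y ] Adj z y × y ≢ x × y ≢ x′
  thirdNeighbour zx zx′ x≢x′ with OtherTwo.exhaust (others zx) (adj⇒neighbour zx′)
  ... | inj₁ x′≡x = ⊥-elim (x≢x′ (sym x′≡x))
  ... | inj₂ (inj₁ x′≡q) = r , neighbour⇒adj r∈l , r≢x , λ r≡x′ → q≢r (trans (sym x′≡q) (sym r≡x′))
    where open OtherTwo (others zx)
  ... | inj₂ (inj₂ x′≡r) = q , neighbour⇒adj q∈l , q≢x , λ q≡x′ → q≢r (trans q≡x′ x′≡r)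
    where open OtherTwo (others zx)

  -- z points to x (within W): z, x ∈ W are adjacent, and every other
  -- neighbour y of z lies in W and forms a 2-path x z y.  This is exactly
  -- when x may have three conflicts in W through z.
  Points : Subset n → Fin n → Fin n → Set
  Points W z x = z ∈ W × x ∈ W × Adj z x × (∀ y → Adj z y → y ≢ x → y ∈ W × Dipath x z y)

  points? : ∀ W z x → Dec (Points W z x)
  points? W z x = (z ∈? W) ×-dec (x ∈? W) ×-dec (adj G z x ≟ᵇ true) ×-dec
    all? (λ y → (adj G z y ≟ᵇ true) →-dec (¬? (y ≟ x) →-dec ((y ∈? W) ×-dec dipath? x z y)))

  -- A vertex points to at most one vertex: otherwise its three neighbours
  -- would be pairwise joined by 2-paths through it.
  points-functional : ∀ {W z x x′} → Points W z x → Points W z x′ → x ≡ x′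
  points-functional {x = x} {x′} (_ , _ , zx , viaX) (_ , _ , zx′ , viaX′) with x ≟ x′
  ... | yes x≡x′ = x≡x′
  ... | no x≢x′ with thirdNeighbour zx zx′ x≢x′
  ...   | y , zy , y≢x , y≢x′ = ⊥-elim (noDipathTriangle (proj₂ (viaX x′ zx′ (≢-sym x≢x′)))
                                                       (proj₂ (viaX y zy y≢x)) (proj₂ (viaX′ y zy y≢x′)))

  -- A source is on no 2-path as the middle vertex, so it points nowhere.
  source-points-nowhere : ∀ {W s x} → IsSource G s → ¬ Points W s x
  source-points-nowhere {x = x} source (_ , _ , sx , viaX) with viaX q (neighbour⇒adj q∈l) q≢x
    where open OtherTwo (others sx)
  ... | _ , inj₁ (xs , _) = noArc (source x) xs
  ... | _ , inj₂ (qs , _) = noArc (source _) qs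

  boundary-points-nowhere : ∀ {W z u x} → Adj z u → u ∉ W → ¬ Points W z x
  boundary-points-nowhere {u = u} {x} zu u∉W (_ , x∈W , _ , viaX) with u ≟ x
  ... | yes refl = u∉W x∈W
  ... | no u≢x = u∉W (proj₁ (viaX u zu u≢x))

  boundaryEdge : ∀ (W : Subset n) {w u} → Walk G w u → w ∈ W → u ∉ W →
                 ∃₂ λ z u′ → z ∈ W × u′ ∉ W × Adj z u′
  boundaryEdge W here w∈W u∉W = ⊥-elim (u∉W w∈W)
  boundaryEdge W {w} (step {v = v} wv walk) w∈W u∉W with v ∈? W
  ... | yes v∈W = boundaryEdge W walk v∈W u∉W
  ... | no v∉W = w , v , w∈W , v∉W , wv

  -- Every nonempty W contains a vertex pointing nowhere: the source if W
  -- is everything, otherwise a vertex on an edge leaving W.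
  idleVertex : IsConnected G → ∀ {s} → IsSource G s → ∀ W → Nonempty W →
               ∃[ z ] z ∈ W × (∀ x → ¬ Points W z x)
  idleVertex connected {s} source W (w , w∈W) with all? (_∈? W)
  ... | yes everything = s , everything s , λ _ → source-points-nowhere source
  ... | no missing with ¬∀⟶∃¬ n (_∈ W) (_∈? W) missing
  ...   | u , u∉W with boundaryEdge W (connected w u) w∈W u∉W
  ...     | z , u′ , z∈W , u′∉W , zu′ = z , z∈W , λ _ → boundary-points-nowhere zu′ u′∉W

  -- If some z₀ ∈ W points nowhere, some x ∈ W is pointed to by nobody:
  -- otherwise "pointer of x" (extended by the identity outside W) would
  -- be an injective self-map of the vertex set missing z₀.
  unpointedVertex : ∀ {W z₀} → z₀ ∈ W → (∀ x → ¬ Points W z₀ x) →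
                    ∃[ x ] x ∈ W × (∀ z → ¬ Points W z x)
  unpointedVertex {W} {z₀} z₀∈W z₀-idle
    with any? (λ x → (x ∈? W) ×-dec ¬? (any? (λ z → points? W z x)))
  ... | yes (x , x∈W , unpointed) = x , x∈W , λ z p → unpointed (z , p)
  ... | no none = ⊥-elim (injective⇒hits pointer pointer-injective z₀ pointer-misses)
    where
      pointerOf : ∀ x → ∃[ z ] ((x ∈ W × Points W z x) ⊎ (x ∉ W × z ≡ x))
      pointerOf x with x ∈? W
      ... | no x∉W = x , inj₂ (x∉W , refl)
      ... | yes x∈W with any? (λ z → points? W z x)
      ...   | yes (z , p) = z , inj₁ (x∈W , p)
      ...   | no unpointed = ⊥-elim (none (x , x∈W , unpointed))

      pointer : Fin n → Fin n
      pointer = proj₁ ∘ pointerOf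

      pointer-injective : Injective _≡_ _≡_ pointer
      pointer-injective {x} {y} same with pointerOf x | pointerOf y
      ... | _ , inj₁ (_ , p) | _ , inj₁ (_ , p′) = points-functional p (subst (λ z → Points W z y) (sym same) p′)
      ... | _ , inj₁ (_ , p) | _ , inj₂ (y∉W , refl) = ⊥-elim (y∉W (subst (_∈ W) same (proj₁ p)))
      ... | _ , inj₂ (x∉W , refl) | _ , inj₁ (_ , p′) = ⊥-elim (x∉W (subst (_∈ W) (sym same) (proj₁ p′)))
      ... | _ , inj₂ (_ , refl) | _ , inj₂ (_ , refl) = same

      pointer-misses : ∀ x → pointer x ≢ z₀
      pointer-misses x with pointerOf x
      ... | _ , inj₁ (_ , p) = λ { refl → z₀-idle x p }
      ... | _ , inj₂ (x∉W , refl) = λ { refl → x∉W z₀∈W }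

  Via : Subset n → Fin n → Fin n → Fin n → Set
  Via W x z v = v ∈ W × (v ≡ z ⊎ Dipath x z v)

  throughNeighbour : ∀ {W x z} → x ∈ W → Adj x z → ¬ Points W z x → CoveredBy 2 (Via W x z)
  throughNeighbour {W} {x} {z} x∈W xz unpointed = coveredByTwoOfThree z q r via-only excluded
    where
      open OtherTwo (others (adj-sym xz))

      via-only : ∀ {v} → Via W x z v → v ≡ z ⊎ v ≡ q ⊎ v ≡ r
      via-only (_ , inj₁ v≡z) = inj₁ v≡z
      via-only (_ , inj₂ path) with exhaust (adj⇒neighbour (dipath-adjʳ path))
      ... | inj₁ refl = ⊥-elim (dipath-irrefl path)
      ... | inj₂ v≡q⊎r = inj₂ v≡q⊎r

      via⇒dipath : ∀ {y} → Adj z y → Via W x z y → y ∈ W × Dipath x z y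
      via⇒dipath zy (_ , inj₁ refl) = ⊥-elim (adj-irrefl zy)
      via⇒dipath _ (y∈W , inj₂ path) = y∈W , path

      excluded : ¬ Via W x z z ⊎ ¬ Via W x z q ⊎ ¬ Via W x z r
      excluded with z ∈? W | (q ∈? W) ×-dec dipath? x z q | (r ∈? W) ×-dec dipath? x z r
      ... | no z∉W | _ | _ = inj₁ (z∉W ∘ proj₁)
      ... | yes _ | no ¬viaQ | _ = inj₂ (inj₁ (¬viaQ ∘ via⇒dipath (neighbour⇒adj q∈l)))
      ... | yes _ | yes _ | no ¬viaR = inj₂ (inj₂ (¬viaR ∘ via⇒dipath (neighbour⇒adj r∈l)))
      ... | yes z∈W | yes viaQ | yes viaR = ⊥-elim (unpointed (z∈W , x∈W , adj-sym xz , viaOthers))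
        where
          viaOthers : ∀ y → Adj z y → y ≢ x → y ∈ W × Dipath x z y
          viaOthers y zy y≢x with exhaust (adj⇒neighbour zy)
          ... | inj₁ y≡x = ⊥-elim (y≢x y≡x)
          ... | inj₂ (inj₁ refl) = viaQ
          ... | inj₂ (inj₂ refl) = viaR

  conflictThrough : ∀ {x v} → Conflict x v → ∃[ z ] z ∈ₗ neighbours x × (v ≡ z ⊎ Dipath x z v)
  conflictThrough (inj₁ xv) = _ , adj⇒neighbour (arc⇒adj xv) , inj₁ refl
  conflictThrough (inj₂ (inj₁ vx)) = _ , adj⇒neighbour (arc⇒adj˘ vx) , inj₁ refl
  conflictThrough (inj₂ (inj₂ (z , path))) = z , adj⇒neighbour (dipath-adjˡ path) , inj₂ path

  open GreedyColouring 6 Conflict conflict-sym conflict-irrefl using (Removable)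

  -- An unpointed vertex has at most 3 · 2 = 6 conflicts in W.
  unpointed⇒removable : ∀ {W x} → x ∈ W → (∀ z → ¬ Points W z x) → Removable W x
  unpointed⇒removable {W} {x} x∈W unpointed =
    x∈W , covered-mono viaSomeNeighbour
            (subst (λ deg → CoveredBy (deg * 2) (λ v → ∃[ z ] z ∈ₗ neighbours x × Via W x z v)) (cubic x)
                   (covered-⋃ (neighbours x)
                      (λ z∈ → throughNeighbour x∈W (neighbour⇒adj z∈) (unpointed _))))
    where
      viaSomeNeighbour : ∀ {v} → v ∈ W × Conflict x v → ∃[ z ] z ∈ₗ neighbours x × Via W x z v
      viaSomeNeighbour (v∈W , xv) with conflictThrough xv
      ... | z , z∈ , through = z , z∈ , v∈W , through

  removableVertex : IsConnected G → ∀ {s} → IsSource G s → ∀ W → Nonempty W → ∃ (Removable W)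
  removableVertex connected source W nonempty with idleVertex connected source W nonempty
  ... | z₀ , z₀∈W , z₀-idle with unpointedVertex z₀∈W z₀-idle
  ...   | x , x∈W , unpointed = x , unpointed⇒removable x∈W unpointed

mainTheorem8 : (n : ℕ) (G : Digraph n) → IsOriented G → IsCubic G → IsConnected G
    → ∃[ s ] ∃[ k ] (IsSource G s × IsSink G k × G s k ≡ true)
    → χ2d≤ G 7
mainTheorem8 n G oriented cubic connected (_ , _ , source , _ , _) =
  7 , ≤-refl , colour , (λ u v uv → proper (inj₁ uv)) ,
  (λ u v w uv vw → proper (inj₂ (inj₂ (v , inj₁ (uv , vw)))))
  where
    open CubicOrientation G oriented cubic
    open GreedyColouring 6 Conflict conflict-sym conflict-irrefl using (greedy)

    colouring : ∃[ c ] (∀ {u v} → Conflict u v → c u ≢ c v)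
    colouring = greedy (removableVertex connected source)

    colour : Fin n → Fin 7
    colour = proj₁ colouring

    proper : ∀ {u v} → Conflict u v → colour u ≢ colour v
    proper = proj₂ colouring
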